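{- Suppose $\Gamma$ is a finite group with a conjugacy class of size $m$. Then $M_{2,g}(\Gamma\times\Gamma)\ge m$, where $g=|\Gamma|/m$.
   Context: For a group $\Gamma$, a set $A\subseteq\Gamma$ is an $S_2[g]$-set if for every $\mu\in\Gamma$ there are at most $g$ pairs $(\alpha_1,\alpha_2)\in A^2$ with $\alpha_1\alpha_2=\mu$. $M_{2,g}(\Gamma)$ is the maximum size of an $S_2[g]$-set in $\Gamma$. -}

module Defs where

open import Level using (0ℓ)
open import Data.Bool using (Bool; _∧_)
open import Data.Nat using (ℕ; _≤_)
open import Data.Product using (_×_; _,_; proj₁; proj₂; ∃)
open import Data.Product.Properties using (≡-dec)
open import Data.List using (List; length; filterᵇ; cartesianProduct)
open import Data.List.Membership.Propositional using (_∈_)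
open import Data.List.Membership.Propositional.Properties using (∈-cartesianProduct⁺)
open import Data.List.Relation.Unary.Unique.Propositional using (Unique)
open import Data.List.Relation.Unary.Unique.Propositional.Properties using (cartesianProduct⁺)
open import Algebra.Structures using (IsGroup)
open import Data.Bool.ListAction using (any)
open import Relation.Binary.Definitions using (DecidableEquality)
open import Relation.Binary.PropositionalEquality using (_≡_; refl; cong₂)
open import Relation.Nullary.Decidable using (⌊_⌋)

record FiniteGroup : Set₁ where
  field
    Carrier  : Set
    _∙_      : Carrier → Carrier → Carrier
    ε        : Carrier
    _⁻¹      : Carrier → Carrier
    isGroup  : IsGroup _≡_ _∙_ ε _⁻¹
    _≟_      : DecidableEquality Carrier
    elements : List Carrier
    complete : ∀ x → x ∈ elements
    unique   : Unique elements

  order : ℕ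
  order = length elements

  count : (Carrier → Bool) → ℕ
  count p = length (filterᵇ p elements)

  conjClass : Carrier → Carrier → Bool
  conjClass x y = any (λ h → ⌊ y ≟ ((h ∙ x) ∙ (h ⁻¹)) ⌋) elements

  HasConjClassOfSize : ℕ → Set
  HasConjClassOfSize m = ∃ λ x → count (conjClass x) ≡ m

  Subset : Set
  Subset = Carrier → Bool

  ∣_∣ : Subset → ℕ
  ∣ A ∣ = count A

  reps : Subset → Carrier → ℕ
  reps A μ = length (filterᵇ (λ p → A (proj₁ p) ∧ A (proj₂ p) ∧ ⌊ (proj₁ p ∙ proj₂ p) ≟ μ ⌋)
                             (cartesianProduct elements elements))

  IsS₂[_]-set : ℕ → Subset → Set
  IsS₂[ g ]-set A = ∀ μ → reps A μ ≤ g

  -- M_{2,g}(Γ) ≥ k : some S₂[g]-set has size at least k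
  -- (equivalent to the maximum M_{2,g}(Γ) being ≥ k, as Γ is finite)
  M₂[_]≥_ : ℕ → ℕ → Set
  M₂[ g ]≥ k = ∃ λ A → IsS₂[ g ]-set A × k ≤ ∣ A ∣

_×ᴳ_ : FiniteGroup → FiniteGroup → FiniteGroup
G ×ᴳ H = record
  { Carrier  = G.Carrier × H.Carrier
  ; _∙_      = λ x y → (proj₁ x G.∙ proj₁ y) , (proj₂ x H.∙ proj₂ y)
  ; ε        = G.ε , H.ε
  ; _⁻¹      = λ x → (proj₁ x G.⁻¹) , (proj₂ x H.⁻¹)
  ; isGroup  = isG
  ; _≟_      = ≡-dec G._≟_ H._≟_
  ; elements = cartesianProduct G.elements H.elements
  ; complete = λ x → ∈-cartesianProduct⁺ (G.complete (proj₁ x)) (H.complete (proj₂ x))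
  ; unique   = cartesianProduct⁺ G.unique H.unique
  }
  where
  module G = FiniteGroup G
  module H = FiniteGroup H
  module GG = IsGroup G.isGroup
  module HG = IsGroup H.isGroup
  isG : IsGroup _≡_ _ _ _
  isG = record
    { isMonoid = record
      { isSemigroup = record
        { isMagma = record
          { isEquivalence = Relation.Binary.PropositionalEquality.isEquivalence
          ; ∙-cong = λ { refl refl → refl } }
        ; assoc = λ x y z → cong₂ _,_ (GG.assoc _ _ _) (HG.assoc _ _ _) }
      ; identity = (λ x → cong₂ _,_ (GG.identityˡ _) (HG.identityˡ _))
                 , (λ x → cong₂ _,_ (GG.identityʳ _) (HG.identityʳ _)) }
    ; inverse = (λ x → cong₂ _,_ (GG.inverseˡ _) (HG.inverseˡ _))
              , (λ x → cong₂ _,_ (GG.inverseʳ _) (HG.inverseʳ _))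
    ; ⁻¹-cong = λ { refl → refl } }
    where import Relation.Binary.PropositionalEquality

{-# OPTIONS --safe #-}
-- Fix x in the given conjugacy class and take A = {(a , x a) | a ∈ Γ}, of size |Γ| ≥ m.
-- If (a₁ , x a₁)(a₂ , x a₂) = (u , v) then a₁ x a₁⁻¹ = x⁻¹ v u⁻¹, and a₁ determines a₂ = a₁⁻¹ u.
-- So a representation of (u , v) is determined by a conjugator of x onto x⁻¹ v u⁻¹.
-- Those conjugators form a coset of the centraliser of x, which has |Γ|/m = g elements.
module Submission where

open import Level using (0ℓ)
open import Algebra.Bundles using (Group)
open import Algebra.Structures using (IsGroup)
open import Data.Bool using (Bool; T; _∧_)
open import Data.Bool.Properties using (T-∧)
open import Data.List using (List; []; _∷_; _++_; length; map; filterᵇ; cartesianProduct)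
open import Data.List.Properties using (length-++; length-map; length-++-sucʳ; length-filter)
open import Data.List.Membership.Propositional using (_∈_)
open import Data.List.Membership.Propositional.Properties
  using (∈-∃++; ∈-++⁻; ∈-++⁺ˡ; ∈-++⁺ʳ; ∈-map⁻; ∈-filter⁺; ∈-filter⁻; ∈-cartesianProduct⁺; ∈-cartesianProduct⁻)
open import Data.List.Relation.Binary.Subset.Propositional using (_⊆_)
import Data.List.Relation.Unary.All as All
import Data.List.Relation.Unary.All.Properties as All
open import Data.List.Relation.Unary.Any as Any using (here; there; any?; satisfied)
open import Data.List.Relation.Unary.Any.Properties using (any⁻)
open import Data.List.Relation.Unary.AllPairs using ([]; _∷_)
open import Data.List.Relation.Unary.Unique.Propositional using (Unique)
open import Data.List.Relation.Unary.Unique.Propositional.Properties using (filter⁺; cartesianProduct⁺)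
open import Data.Nat using (ℕ; suc; _+_; _*_; _≤_; z≤n; s≤s; NonZero)
open import Data.Nat.Properties using (≤-trans; *-comm; *-cancelˡ-≤; m*n≢0⇒n≢0; module ≤-Reasoning)
open import Data.Product using (_×_; _,_; proj₁; proj₂)
open import Data.Product.Properties using (,-injective)
open import Data.Sum using (inj₁; inj₂)
open import Function using (_∘_; Equivalence)
open import Relation.Binary.PropositionalEquality
open import Relation.Nullary using (yes; no; contradiction)
open import Relation.Nullary.Decidable using (T?; ⌊_⌋; toWitness; fromWitness)

open import Defs

module _ {A : Set} where

  Unique-⊆⇒length≤ : {xs ys : List A} → Unique xs → xs ⊆ ys → length xs ≤ length ys
  Unique-⊆⇒length≤ {[]} _ _ = z≤n
  Unique-⊆⇒length≤ {x ∷ xs} (x∉xs ∷ xs!) xs⊆ys with ys₁ , ys₂ , refl ← ∈-∃++ (xs⊆ys (here refl)) = begin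
    suc (length xs)           ≤⟨ s≤s (Unique-⊆⇒length≤ xs! xs⊆ys₁++ys₂) ⟩
    suc (length (ys₁ ++ ys₂)) ≡⟨ length-++-sucʳ ys₁ x ys₂ ⟨
    length (ys₁ ++ x ∷ ys₂)   ∎
    where
    open ≤-Reasoning
    xs⊆ys₁++ys₂ : xs ⊆ ys₁ ++ ys₂
    xs⊆ys₁++ys₂ z∈xs with ∈-++⁻ ys₁ (xs⊆ys (there z∈xs))
    ... | inj₁ z∈ys₁         = ∈-++⁺ˡ z∈ys₁
    ... | inj₂ (here refl)   = contradiction refl (All.lookup x∉xs z∈xs)
    ... | inj₂ (there z∈ys₂) = ∈-++⁺ʳ ys₁ z∈ys₂

  nonZero-length : {z : A} {xs : List A} → z ∈ xs → NonZero (length xs)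
  nonZero-length (here _)  = _
  nonZero-length (there _) = _

  length≤-from-member : {xs : List A} {n : ℕ} → (∀ {z} → z ∈ xs → length xs ≤ n) → length xs ≤ n
  length≤-from-member {[]}    _     = z≤n
  length≤-from-member {_ ∷ _} bound = bound (here refl)

  module _ (p : A → Bool) where

    ∈-filterᵇ⁺ : {z : A} {xs : List A} → z ∈ xs → T (p z) → z ∈ filterᵇ p xs
    ∈-filterᵇ⁺ = ∈-filter⁺ (T? ∘ p)

    ∈-filterᵇ⁻ : {z : A} (xs : List A) → z ∈ filterᵇ p xs → T (p z)
    ∈-filterᵇ⁻ xs = proj₂ ∘ ∈-filter⁻ (T? ∘ p) {xs = xs}

    Unique-filterᵇ : {xs : List A} → Unique xs → Unique (filterᵇ p xs)
    Unique-filterᵇ = filter⁺ (T? ∘ p)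

module _ {A B : Set} where

  InjectiveOn : (A → B) → List A → Set
  InjectiveOn f xs = ∀ {a b} → a ∈ xs → b ∈ xs → f a ≡ f b → a ≡ b

  Unique-map⁺ : (f : A → B) {xs : List A} → InjectiveOn f xs → Unique xs → Unique (map f xs)
  Unique-map⁺ f {[]}     _   []            = []
  Unique-map⁺ f {x ∷ xs} inj (x∉xs ∷ xs!) =
    All.map⁺ (All.tabulate λ z∈xs fx≡fz → All.lookup x∉xs z∈xs (inj (here refl) (there z∈xs) fx≡fz))
    ∷ Unique-map⁺ f (λ a∈xs b∈xs → inj (there a∈xs) (there b∈xs)) xs!

  injectiveOn⇒length≤ : (f : A → B) {xs : List A} {ys : List B} → Unique xs →
                         (∀ {a} → a ∈ xs → f a ∈ ys) → InjectiveOn f xs → length xs ≤ length ys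
  injectiveOn⇒length≤ f {xs} {ys} xs! f[xs]⊆ys inj = begin
    length xs         ≡⟨ length-map f xs ⟨
    length (map f xs) ≤⟨ Unique-⊆⇒length≤ (Unique-map⁺ f inj xs!) map-f-xs⊆ys ⟩
    length ys         ∎
    where
    open ≤-Reasoning
    map-f-xs⊆ys : map f xs ⊆ ys
    map-f-xs⊆ys fa∈ with _ , a∈xs , refl ← ∈-map⁻ f fa∈ = f[xs]⊆ys a∈xs

  length-cartesianProduct : (xs : List A) (ys : List B) →
                            length (cartesianProduct xs ys) ≡ length xs * length ys
  length-cartesianProduct []       ys = refl
  length-cartesianProduct (x ∷ xs) ys = begin
    length (map (x ,_) ys ++ cartesianProduct xs ys)         ≡⟨ length-++ (map (x ,_) ys) ⟩
    length (map (x ,_) ys) + length (cartesianProduct xs ys) ≡⟨ cong₂ _+_ (length-map (x ,_) ys)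
                                                                          (length-cartesianProduct xs ys) ⟩
    length ys + length xs * length ys                        ∎
    where open ≡-Reasoning

module _ (Γ : FiniteGroup) where

  open FiniteGroup Γ
  open IsGroup isGroup using (assoc; identityˡ; identityʳ; inverseˡ)

  group : Group 0ℓ 0ℓ
  group = record { isGroup = isGroup }

  open import Algebra.Properties.Group group
    using (∙-cancelˡ; ⁻¹-anti-homo-∙; ε⁻¹≈ε; \\-leftDividesʳ; //-rightDividesʳ)

  conj : Carrier → Carrier → Carrier
  conj h z = (h ∙ z) ∙ (h ⁻¹)

  conj-∙ : ∀ h k z → conj (h ∙ k) z ≡ conj h (conj k z)
  conj-∙ h k z = begin
    ((h ∙ k) ∙ z) ∙ ((h ∙ k) ⁻¹)       ≡⟨ cong (((h ∙ k) ∙ z) ∙_) (⁻¹-anti-homo-∙ h k) ⟩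
    ((h ∙ k) ∙ z) ∙ ((k ⁻¹) ∙ (h ⁻¹)) ≡⟨ assoc ((h ∙ k) ∙ z) (k ⁻¹) (h ⁻¹) ⟨
    (((h ∙ k) ∙ z) ∙ (k ⁻¹)) ∙ (h ⁻¹) ≡⟨ cong (λ w → (w ∙ (k ⁻¹)) ∙ (h ⁻¹)) (assoc h k z) ⟩
    ((h ∙ (k ∙ z)) ∙ (k ⁻¹)) ∙ (h ⁻¹) ≡⟨ cong (_∙ (h ⁻¹)) (assoc h (k ∙ z) (k ⁻¹)) ⟩
    (h ∙ ((k ∙ z) ∙ (k ⁻¹))) ∙ (h ⁻¹) ∎
    where open ≡-Reasoning

  conj-ε : ∀ z → conj ε z ≡ z
  conj-ε z = trans (cong₂ _∙_ (identityˡ z) ε⁻¹≈ε) (identityʳ z)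

  conj-⁻¹-conj : ∀ h z → conj (h ⁻¹) (conj h z) ≡ z
  conj-⁻¹-conj h z = begin
    conj (h ⁻¹) (conj h z) ≡⟨ conj-∙ (h ⁻¹) h z ⟨
    conj ((h ⁻¹) ∙ h) z    ≡⟨ cong (λ w → conj w z) (inverseˡ h) ⟩
    conj ε z               ≡⟨ conj-ε z ⟩
    z                      ∎
    where open ≡-Reasoning

  conj-from-product : ∀ x a b → ((x ⁻¹) ∙ ((x ∙ a) ∙ (x ∙ b))) ∙ ((a ∙ b) ⁻¹) ≡ conj a x
  conj-from-product x a b = begin
    ((x ⁻¹) ∙ ((x ∙ a) ∙ (x ∙ b))) ∙ ((a ∙ b) ⁻¹)   ≡⟨ cong (_∙ ((a ∙ b) ⁻¹)) (assoc (x ⁻¹) (x ∙ a) (x ∙ b)) ⟨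
    (((x ⁻¹) ∙ (x ∙ a)) ∙ (x ∙ b)) ∙ ((a ∙ b) ⁻¹)   ≡⟨ cong₂ (λ w w′ → (w ∙ (x ∙ b)) ∙ w′)
                                                             (\\-leftDividesʳ x a) (⁻¹-anti-homo-∙ a b) ⟩
    (a ∙ (x ∙ b)) ∙ ((b ⁻¹) ∙ (a ⁻¹))               ≡⟨ assoc (a ∙ (x ∙ b)) (b ⁻¹) (a ⁻¹) ⟨
    ((a ∙ (x ∙ b)) ∙ (b ⁻¹)) ∙ (a ⁻¹)               ≡⟨ cong (λ w → (w ∙ (b ⁻¹)) ∙ (a ⁻¹)) (assoc a x b) ⟨
    (((a ∙ x) ∙ b) ∙ (b ⁻¹)) ∙ (a ⁻¹)               ≡⟨ cong (_∙ (a ⁻¹)) (//-rightDividesʳ b (a ∙ x)) ⟩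
    (a ∙ x) ∙ (a ⁻¹)                                ∎
    where open ≡-Reasoning

  conjugators : Carrier → Carrier → Subset
  conjugators x y h = ⌊ conj h x ≟ y ⌋

  module _ (x : Carrier) where

    representative : Carrier → Carrier
    representative c with any? (λ h → c ≟ conj h x) elements
    ... | yes found = proj₁ (satisfied found)
    ... | no  _     = ε

    conj-representative : ∀ {c} → T (conjClass x c) → conj (representative c) x ≡ c
    conj-representative {c} c∈x^Γ with any? (λ h → c ≟ conj h x) elements
    ... | yes found = sym (proj₂ (satisfied found))
    ... | no  none  = contradiction (Any.map toWitness (any⁻ _ elements c∈x^Γ)) none

    conj-⁻¹∙-fixes : ∀ h s → conj s x ≡ conj h x → conj ((h ⁻¹) ∙ s) x ≡ x
    conj-⁻¹∙-fixes h s sx≡hx = begin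
      conj ((h ⁻¹) ∙ s) x       ≡⟨ conj-∙ (h ⁻¹) s x ⟩
      conj (h ⁻¹) (conj s x)    ≡⟨ cong (conj (h ⁻¹)) sx≡hx ⟩
      conj (h ⁻¹) (conj h x)    ≡⟨ conj-⁻¹-conj h x ⟩
      x                         ∎
      where open ≡-Reasoning

    -- Orbit–stabiliser: (c , s) ↦ representative c ∙ h₀⁻¹ ∙ s embeds x^Γ × {s | s x s⁻¹ = y} into Γ.
    ∣conjClass∣*∣conjugators∣≤order : ∀ {y h₀} → T (conjugators x y h₀) →
                                      ∣ conjClass x ∣ * ∣ conjugators x y ∣ ≤ order
    ∣conjClass∣*∣conjugators∣≤order {y} {h₀} h₀x≡y = begin
      ∣ conjClass x ∣ * ∣ conjugators x y ∣ ≡⟨ length-cartesianProduct class fibre ⟨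
      length (cartesianProduct class fibre) ≤⟨ injectiveOn⇒length≤ embed class×fibre! (λ _ → complete _)
                                                                   embed-injective ⟩
      order                                 ∎
      where
      open ≤-Reasoning
      class fibre : List Carrier
      class = filterᵇ (conjClass x) elements
      fibre = filterᵇ (conjugators x y) elements

      class×fibre! : Unique (cartesianProduct class fibre)
      class×fibre! = cartesianProduct⁺ (Unique-filterᵇ (conjClass x) unique)
                                       (Unique-filterᵇ (conjugators x y) unique)

      embed : Carrier × Carrier → Carrier
      embed (c , s) = representative c ∙ ((h₀ ⁻¹) ∙ s)

      conj-embed : ∀ {c s} → c ∈ class → s ∈ fibre → conj (embed (c , s)) x ≡ c
      conj-embed {c} {s} c∈ s∈ =
        trans (conj-∙ (representative c) ((h₀ ⁻¹) ∙ s) x)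
              (trans (cong (conj (representative c)) (conj-⁻¹∙-fixes h₀ s sx≡h₀x))
                     (conj-representative (∈-filterᵇ⁻ (conjClass x) elements c∈)))
        where
        sx≡h₀x : conj s x ≡ conj h₀ x
        sx≡h₀x = trans (toWitness (∈-filterᵇ⁻ (conjugators x y) elements s∈)) (sym (toWitness h₀x≡y))

      embed-injective : InjectiveOn embed (cartesianProduct class fibre)
      embed-injective {c , s} {c′ , s′} cs∈ c′s′∈ embed≡
        with c∈ , s∈ ← ∈-cartesianProduct⁻ class fibre cs∈
        with c′∈ , s′∈ ← ∈-cartesianProduct⁻ class fibre c′s′∈
        with refl ← trans (sym (conj-embed c∈ s∈))
                          (trans (cong (λ h → conj h x) embed≡) (conj-embed c′∈ s′∈))
        = cong (c ,_) (∙-cancelˡ (h₀ ⁻¹) s s′ (∙-cancelˡ (representative c) _ _ embed≡))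

    ∣conjugators∣≤ : ∀ {g} → g * ∣ conjClass x ∣ ≡ order → ∀ y → ∣ conjugators x y ∣ ≤ g
    ∣conjugators∣≤ {g} g*m≡order y = length≤-from-member λ h₀∈ → *-cancelˡ-≤ m {{m≢0}} (begin
      m * ∣ conjugators x y ∣ ≤⟨ ∣conjClass∣*∣conjugators∣≤order
                                   (∈-filterᵇ⁻ (conjugators x y) elements h₀∈) ⟩
      order                   ≡⟨ g*m≡order ⟨
      g * m                   ≡⟨ *-comm g m ⟩
      m * g                   ∎)
      where
      open ≤-Reasoning
      m : ℕ
      m = ∣ conjClass x ∣
      m≢0 : NonZero m
      m≢0 = m*n≢0⇒n≢0 g {{subst NonZero (sym g*m≡order) (nonZero-length (complete ε))}}

  module Γ² = FiniteGroup (Γ ×ᴳ Γ)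

  module _ (x : Carrier) where

    translationGraph : Γ².Subset
    translationGraph (a , b) = ⌊ b ≟ (x ∙ a) ⌋

    ∣conjClass∣≤∣translationGraph∣ : ∣ conjClass x ∣ ≤ Γ².∣ translationGraph ∣
    ∣conjClass∣≤∣translationGraph∣ = begin
      ∣ conjClass x ∣         ≤⟨ length-filter (T? ∘ conjClass x) elements ⟩
      order                   ≤⟨ injectiveOn⇒length≤ (λ a → a , x ∙ a) unique graph∈ (λ _ _ → cong proj₁) ⟩
      Γ².∣ translationGraph ∣ ∎
      where
      open ≤-Reasoning
      graph∈ : ∀ {a} → a ∈ elements → (a , x ∙ a) ∈ filterᵇ translationGraph Γ².elements
      graph∈ {a} _ = ∈-filterᵇ⁺ translationGraph (∈-cartesianProduct⁺ (complete a) (complete (x ∙ a)))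
                                (fromWitness refl)

    IsRepresentation : Γ².Carrier → Γ².Carrier × Γ².Carrier → Bool
    IsRepresentation μ (α₁ , α₂) = translationGraph α₁ ∧ translationGraph α₂ ∧ ⌊ (α₁ Γ².∙ α₂) Γ².≟ μ ⌋

    representation-equations : ∀ {u v a₁ b₁ a₂ b₂} →
                               T (IsRepresentation (u , v) ((a₁ , b₁) , (a₂ , b₂))) →
                               b₁ ≡ x ∙ a₁ × b₂ ≡ x ∙ a₂ × a₁ ∙ a₂ ≡ u × b₁ ∙ b₂ ≡ v
    representation-equations {a₁ = a₁} {b₁} {a₂} {b₂} t
      with graph₁ , t′      ← Equivalence.to (T-∧ {translationGraph (a₁ , b₁)}) t
      with graph₂ , product ← Equivalence.to (T-∧ {translationGraph (a₂ , b₂)}) t′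
      with a-product , b-product ← ,-injective (toWitness product)
      = toWitness graph₁ , toWitness graph₂ , a-product , b-product

    reps-translationGraph≤ : ∀ u v →
                             Γ².reps translationGraph (u , v) ≤ ∣ conjugators x (((x ⁻¹) ∙ v) ∙ (u ⁻¹)) ∣
    reps-translationGraph≤ u v =
      injectiveOn⇒length≤ (proj₁ ∘ proj₁) (Unique-filterᵇ _ (cartesianProduct⁺ Γ².unique Γ².unique))
                          first∈ first-injective
      where
      y : Carrier
      y = ((x ⁻¹) ∙ v) ∙ (u ⁻¹)

      pairs representations : List (Γ².Carrier × Γ².Carrier)
      pairs = cartesianProduct Γ².elements Γ².elements
      representations = filterᵇ (IsRepresentation (u , v)) pairs

      first∈ : ∀ {α} → α ∈ representations → proj₁ (proj₁ α) ∈ filterᵇ (conjugators x y) elements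
      first∈ {(a₁ , _) , (a₂ , _)} α∈
        with refl , refl , a₁a₂≡u , b₁b₂≡v ← representation-equations (∈-filterᵇ⁻ _ pairs α∈)
        = ∈-filterᵇ⁺ _ (complete a₁) (fromWitness (sym (trans
            (cong₂ (λ v′ u′ → ((x ⁻¹) ∙ v′) ∙ (u′ ⁻¹)) (sym b₁b₂≡v) (sym a₁a₂≡u))
            (conj-from-product x a₁ a₂))))

      first-injective : InjectiveOn (proj₁ ∘ proj₁) representations
      first-injective {(a₁ , _) , (a₂ , _)} {(_ , _) , (a₂′ , _)} α∈ α′∈ refl
        with refl , refl , a₁a₂≡u  , _ ← representation-equations (∈-filterᵇ⁻ _ pairs α∈)
        with refl , refl , a₁a₂′≡u , _ ← representation-equations (∈-filterᵇ⁻ _ pairs α′∈)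
        with refl ← ∙-cancelˡ a₁ a₂ a₂′ (trans a₁a₂≡u (sym a₁a₂′≡u))
        = refl

    translationGraph-isS₂ : ∀ {g} → g * ∣ conjClass x ∣ ≡ order → Γ².IsS₂[ g ]-set translationGraph
    translationGraph-isS₂ g*m≡order (u , v) = ≤-trans (reps-translationGraph≤ u v) (∣conjugators∣≤ x g*m≡order _)

proposition4p2 : (Γ : FiniteGroup) (m g : ℕ) →
    FiniteGroup.HasConjClassOfSize Γ m →
    g * m ≡ FiniteGroup.order Γ →
    FiniteGroup.M₂[_]≥_ (Γ ×ᴳ Γ) g m
proposition4p2 Γ _ g (x , refl) g*m≡order =
  translationGraph Γ x , translationGraph-isS₂ Γ x g*m≡order , ∣conjClass∣≤∣translationGraph∣ Γ x
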